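{- For all integers $k\ge 3$ and $t\ge 1$, $C_k\le C_{t(k-2)+2}$. In particular, for every $t\ge 2$, $C_4\le C_{2t}$.
   Context: All graphs are finite and simple, considered up to isomorphism. An edge-colored graph is a pair $(G,c)$ with $c\colon E(G)\to\mathbb{N}$ an arbitrary map (not necessarily proper); it is colored in $t$ or more colors if $|c(E(G))|\ge t$. A subgraph (not necessarily induced) is rainbow if its edges receive pairwise distinct colors. $(G,c)$ is rainbow $H$-free if $G$ contains no rainbow subgraph isomorphic to $H$. For graphs $H_1,H_2$, write $H_1\le H_2$ if there is a positive integer $s$ such that every rainbow $H_1$-free edge-colored complete graph colored in $s$ or more colors is rainbow $H_2$-free. $C_k$ is the cycle on $k$ vertices. -}

module Defs where

open import Data.Nat using (ℕ; zero; suc; _+_; _*_; _∸_; _≤_)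
open import Data.Fin using (Fin; toℕ)
open import Data.Product using (Σ; ∃; _×_; _,_)
open import Data.Sum using (_⊎_)
import Data.Sum
import Relation.Binary.PropositionalEquality
open import Relation.Binary.PropositionalEquality using (_≡_)
open import Relation.Nullary using (¬_)
open import Function.Definitions using (Injective)

record Graph : Set₁ where
  field
    V     : ℕ
    Adj   : Fin V → Fin V → Set
    sym   : ∀ {a b} → Adj a b → Adj b a
    irref : ∀ {a} → ¬ Adj a a
open Graph public

-- Edge-coloring of the complete graph K_n on vertex set Fin n:
-- a colour c i j for each unordered pair {i,j}, i ≠ j (symmetric; the
-- diagonal values c i i are irrelevant and never used).
record Coloring (n : ℕ) : Set where
  field
    col  : Fin n → Fin n → ℕ
    csym : ∀ i j → col i j ≡ col j i
open Coloring public

-- (K_n , c) is colored in s or more colors: there are s edges of K_n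
-- with pairwise distinct colours (i.e. |c(E(K_n))| ≥ s).
ColoredInAtLeast : ∀ {n} → Coloring n → ℕ → Set
ColoredInAtLeast {n} c s =
  Σ (Fin s → Fin n × Fin n) λ e →
    (∀ x → let (i , j) = e x in ¬ i ≡ j) ×
    Injective _≡_ _≡_ (λ x → let (i , j) = e x in col c i j)

-- A rainbow copy of H in (K_n , c): an injective vertex map f (so the
-- image of H is a subgraph of K_n isomorphic to H) such that distinct
-- edges of H receive distinct colours.
RainbowCopy : ∀ {n} → Coloring n → Graph → Set
RainbowCopy {n} c H =
  Σ (Fin (V H) → Fin n) λ f →
    Injective _≡_ _≡_ f ×
    (∀ a b a' b' → Adj H a b → Adj H a' b' →
       col c (f a) (f b) ≡ col c (f a') (f b') →
       (a ≡ a' × b ≡ b') ⊎ (a ≡ b' × b ≡ a'))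

RainbowFree : ∀ {n} → Coloring n → Graph → Set
RainbowFree c H = ¬ RainbowCopy c H

_≼_ : Graph → Graph → Set
H₁ ≼ H₂ = Σ ℕ λ s → 1 ≤ s ×
  (∀ n (c : Coloring n) → ColoredInAtLeast c s →
     RainbowFree c H₁ → RainbowFree c H₂)

CycStep : (k : ℕ) → Fin k → Fin k → Set
CycStep k i j = (toℕ j ≡ suc (toℕ i)) ⊎ (toℕ i ≡ k ∸ 1 × toℕ j ≡ 0)

CycAdj : (k : ℕ) → Fin k → Fin k → Set
CycAdj k i j = (CycStep k i j ⊎ CycStep k j i) × ¬ i ≡ j

Cycle : ℕ → Graph
Cycle k = record
  { V = k
  ; Adj = CycAdj k
  ; sym = λ { (Data.Sum.inj₁ p , ne) → Data.Sum.inj₂ p , λ e → ne (Relation.Binary.PropositionalEquality.sym e)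
            ; (Data.Sum.inj₂ p , ne) → Data.Sum.inj₁ p , λ e → ne (Relation.Binary.PropositionalEquality.sym e) }
  ; irref = λ { (_ , ne) → ne Relation.Binary.PropositionalEquality.refl }
  }

{-# OPTIONS --safe #-}
-- Let w₀ … w_{m−1} be a rainbow cycle, m = t·d + 2, and call the chord w₀w_p
-- ahead if its colour is that of some cycle edge w_i w_{i+1} with i ≥ p.
-- The chord w₀w₁ is the edge 0, whose colour occurs only once, so it is not
-- ahead; the chord w₀w_{m−1} is the edge m − 1, so it is ahead. Hence for some
-- p = j·d + 1 the chord at p is not ahead while the chord at p + d is, and then
-- w₀, w_p, w_{p+1}, …, w_{p+d} is a rainbow cycle of length d + 2: the second
-- chord repeats an edge colour beyond the path, and the first chord's colour
-- is none of the colours from w_p on.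
module Submission where

open import Defs hiding (sym)
open import Data.Nat using (ℕ; zero; suc; pred; _+_; _*_; _∸_; _≤_; _<_; z≤n; s≤s; s≤s⁻¹; z<s; NonZero)
open import Data.Nat.Properties
open import Data.Nat.DivMod using (_%_; _mod_; m<n⇒m%n≡m; n%n≡0; m%n%n≡m%n)
open import Data.Fin using (Fin; toℕ)
open import Data.Fin.Properties using (toℕ-injective; toℕ<n; toℕ-fromℕ<)
open import Data.Product using (∃-syntax; _×_; _,_; swap)
open import Data.Sum using (_⊎_; inj₁; inj₂)
open import Data.Empty using (⊥-elim)
open import Function using (_∘_)
open import Function.Definitions using (Injective)
open import Relation.Nullary using (¬_)
open import Relation.Binary.PropositionalEquality

InjectiveBelow : {A : Set} → ℕ → (ℕ → A) → Set
InjectiveBelow k f = ∀ {i j} → i < k → j < k → f i ≡ f j → i ≡ j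

module _ {A : Set} {k : ℕ} where

  injectiveBelow-∘ : ∀ {m} {g : ℕ → A} {h : ℕ → ℕ} →
                     InjectiveBelow m g → InjectiveBelow k h → (∀ {i} → i < k → h i < m) →
                     InjectiveBelow k (g ∘ h)
  injectiveBelow-∘ g-inj h-inj h<m i<k j<k = h-inj i<k j<k ∘ g-inj (h<m i<k) (h<m j<k)

  injectiveBelow-resp : ∀ {f g : ℕ → A} → (∀ {i} → i < k → f i ≡ g i) →
                        InjectiveBelow k f → InjectiveBelow k g
  injectiveBelow-resp f≗g f-inj i<k j<k eq =
    f-inj i<k j<k (trans (f≗g i<k) (trans eq (sym (f≗g j<k))))

  injectiveBelow-cons : ∀ {f : ℕ → A} → InjectiveBelow k (f ∘ suc) →
                        (∀ {i} → i < k → f 0 ≢ f (suc i)) → InjectiveBelow (suc k) f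
  injectiveBelow-cons _     _   {zero}  {zero}  _   _   _  = refl
  injectiveBelow-cons _     new {zero}  {suc j} _   j<k eq = ⊥-elim (new (s≤s⁻¹ j<k) eq)
  injectiveBelow-cons _     new {suc i} {zero}  i<k _   eq = ⊥-elim (new (s≤s⁻¹ i<k) (sym eq))
  injectiveBelow-cons f-inj _   {suc i} {suc j} i<k j<k eq =
    cong suc (f-inj (s≤s⁻¹ i<k) (s≤s⁻¹ j<k) eq)

  injectiveBelow-snoc : ∀ {f : ℕ → A} → InjectiveBelow k f →
                        (∀ {i} → i < k → f i ≢ f k) → InjectiveBelow (suc k) f
  injectiveBelow-snoc f-inj new i<1+k j<1+k eq
    with m≤n⇒m<n∨m≡n (s≤s⁻¹ i<1+k) | m≤n⇒m<n∨m≡n (s≤s⁻¹ j<1+k)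
  ... | inj₁ i<k  | inj₁ j<k  = f-inj i<k j<k eq
  ... | inj₁ i<k  | inj₂ refl = ⊥-elim (new i<k eq)
  ... | inj₂ refl | inj₁ j<k  = ⊥-elim (new j<k (sym eq))
  ... | inj₂ refl | inj₂ refl = refl

module _ {k : ℕ} .{{_ : NonZero k}} where

  suc[pred[n]]%n≡0 : suc (pred k) % k ≡ 0
  suc[pred[n]]%n≡0 = trans (cong (_% k) (suc-pred k)) (n%n≡0 k)

  suc[m]%n-cases : ∀ {i} → i < k → (suc i < k × suc i % k ≡ suc i) ⊎ (suc i ≡ k × suc i % k ≡ 0)
  suc[m]%n-cases i<k with m≤n⇒m<n∨m≡n i<k
  ... | inj₁ 1+i<k = inj₁ (1+i<k , m<n⇒m%n≡m 1+i<k)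
  ... | inj₂ 1+i≡k = inj₂ (1+i≡k , trans (cong (_% k) 1+i≡k) (n%n≡0 k))

  m≢suc[suc[m]%n]%n : ∀ {i} → 3 ≤ k → i < k → i ≢ suc (suc i % k) % k
  m≢suc[suc[m]%n]%n {i} 3≤k i<k i≡ with suc[m]%n-cases i<k
  ... | inj₂ (1+i≡k , 1+i%k≡0) = <⇒≢ 3≤k (trans (cong suc (sym i≡1)) 1+i≡k)
    where
    i≡1 : i ≡ 1
    i≡1 = trans i≡ (trans (cong (λ x → suc x % k) 1+i%k≡0) (m<n⇒m%n≡m (<⇒≤ 3≤k)))
  ... | inj₁ (1+i<k , 1+i%k≡1+i) with suc[m]%n-cases 1+i<k
  ...   | inj₁ (_ , 2+i%k≡2+i) =
    <⇒≢ (m<n+m i z<s) (trans i≡ (trans (cong (λ x → suc x % k) 1+i%k≡1+i) 2+i%k≡2+i))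
  ...   | inj₂ (2+i≡k , 2+i%k≡0) = <⇒≢ 3≤k (trans (cong (2 +_) (sym i≡0)) 2+i≡k)
    where
    i≡0 : i ≡ 0
    i≡0 = trans i≡ (trans (cong (λ x → suc x % k) 1+i%k≡1+i) 2+i%k≡0)

  cycStep⇒≡suc% : ∀ {a b : Fin k} → CycStep k a b → toℕ b ≡ suc (toℕ a) % k
  cycStep⇒≡suc% {b = b} (inj₁ b≡1+a) =
    trans b≡1+a (sym (m<n⇒m%n≡m (subst (_< k) b≡1+a (toℕ<n b))))
  cycStep⇒≡suc% (inj₂ (a≡pred[k] , b≡0)) =
    trans b≡0 (sym (trans (cong (λ x → suc x % k) a≡pred[k]) suc[pred[n]]%n≡0))

  ≡suc%⇒cycAdj : ∀ {a b : Fin k} → 2 ≤ k → toℕ b ≡ suc (toℕ a) % k → CycAdj k a b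
  ≡suc%⇒cycAdj {a} {b} 2≤k b≡ with suc[m]%n-cases (toℕ<n a)
  ... | inj₁ (_ , 1+a%k≡1+a) =
    inj₁ (inj₁ b≡1+a) , λ a≡b → 1+n≢n (sym (trans (cong toℕ a≡b) b≡1+a))
    where
    b≡1+a : toℕ b ≡ suc (toℕ a)
    b≡1+a = trans b≡ 1+a%k≡1+a
  ... | inj₂ (1+a≡k , 1+a%k≡0) =
    inj₁ (inj₂ (cong pred 1+a≡k , b≡0)) ,
    λ a≡b → <⇒≢ 2≤k (trans (cong suc (sym (trans (cong toℕ a≡b) b≡0))) 1+a≡k)
    where
    b≡0 : toℕ b ≡ 0
    b≡0 = trans b≡ 1+a%k≡0

module _ {n : ℕ} (c : Coloring n) where

  cycleColour : (k : ℕ) .{{_ : NonZero k}} → (ℕ → Fin n) → ℕ → ℕ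
  cycleColour k w i = col c (w i) (w (suc i % k))

  -- The cycle vertex 0, …, vertex (k − 1); the values of vertex from k on are
  -- irrelevant, and edge i joins vertex i to vertex ((i + 1) mod k).
  record RainbowCycle (k : ℕ) .{{_ : NonZero k}} : Set where
    field
      vertex           : ℕ → Fin n
      vertex-injective : InjectiveBelow k vertex
      colour-injective : InjectiveBelow k (cycleColour k vertex)

  module _ {k : ℕ} .{{_ : NonZero k}} (w : ℕ → Fin n) where

    cycleColour-< : ∀ {i} → suc i < k → cycleColour k w i ≡ col c (w i) (w (suc i))
    cycleColour-< {i} 1+i<k = cong (col c (w i) ∘ w) (m<n⇒m%n≡m 1+i<k)

    cycleColour-pred : cycleColour k w (pred k) ≡ col c (w 0) (w (pred k))
    cycleColour-pred = trans (cong (col c (w (pred k)) ∘ w) suc[pred[n]]%n≡0) (csym c _ _)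

module _ {n : ℕ} {c : Coloring n} {k : ℕ} .{{_ : NonZero k}} where

  rainbowCycle⇒rainbowCopy : RainbowCycle c k → RainbowCopy c (Cycle k)
  rainbowCycle⇒rainbowCopy C = f , f-injective , rainbow
    where
    open RainbowCycle C

    f : Fin k → Fin n
    f = vertex ∘ toℕ

    f-injective : Injective _≡_ _≡_ f
    f-injective {a} {b} = toℕ-injective ∘ vertex-injective (toℕ<n a) (toℕ<n b)

    stepColour : ∀ {a b} → CycStep k a b → col c (f a) (f b) ≡ cycleColour c k vertex (toℕ a)
    stepColour {a} s = cong (col c (f a) ∘ vertex) (cycStep⇒≡suc% s)

    sameStep : ∀ {a b a′ b′} → CycStep k a b → CycStep k a′ b′ →
               col c (f a) (f b) ≡ col c (f a′) (f b′) → a ≡ a′ × b ≡ b′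
    sameStep {a} {b} {a′} {b′} s s′ eq = toℕ-injective a≡a′ , toℕ-injective (begin
      toℕ b             ≡⟨ cycStep⇒≡suc% s ⟩
      suc (toℕ a) % k   ≡⟨ cong (λ x → suc x % k) a≡a′ ⟩
      suc (toℕ a′) % k  ≡⟨ cycStep⇒≡suc% s′ ⟨
      toℕ b′            ∎)
      where
      open ≡-Reasoning
      a≡a′ : toℕ a ≡ toℕ a′
      a≡a′ = colour-injective (toℕ<n a) (toℕ<n a′)
               (trans (sym (stepColour s)) (trans eq (stepColour s′)))

    rainbow : ∀ a b a′ b′ → CycAdj k a b → CycAdj k a′ b′ →
              col c (f a) (f b) ≡ col c (f a′) (f b′) → (a ≡ a′ × b ≡ b′) ⊎ (a ≡ b′ × b ≡ a′)
    rainbow _ _ _ _ (inj₁ s , _) (inj₁ s′ , _) eq = inj₁ (sameStep s s′ eq)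
    rainbow _ _ _ _ (inj₁ s , _) (inj₂ s′ , _) eq = inj₂ (sameStep s s′ (trans eq (csym c _ _)))
    rainbow _ _ _ _ (inj₂ s , _) (inj₁ s′ , _) eq = inj₂ (swap (sameStep s s′ (trans (csym c _ _) eq)))
    rainbow _ _ _ _ (inj₂ s , _) (inj₂ s′ , _) eq =
      inj₁ (swap (sameStep s s′ (trans (csym c _ _) (trans eq (csym c _ _)))))

  -- For k = 2 the two edges of Cycle k are the same edge, so a rainbow copy
  -- need not have distinct edge colours.
  rainbowCopy⇒rainbowCycle : 3 ≤ k → RainbowCopy c (Cycle k) → RainbowCycle c k
  rainbowCopy⇒rainbowCycle 3≤k (f , f-injective , rainbow) = record
    { vertex           = vertex
    ; vertex-injective = λ i<k j<k → mod-injective i<k j<k ∘ f-injective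
    ; colour-injective = colour-injective
    }
    where
    vertex : ℕ → Fin n
    vertex i = f (i mod k)

    toℕ-mod-< : ∀ {i} → i < k → toℕ (i mod k) ≡ i
    toℕ-mod-< i<k = trans (toℕ-fromℕ< _) (m<n⇒m%n≡m i<k)

    toℕ-suc%-mod : ∀ i → toℕ ((suc i % k) mod k) ≡ suc i % k
    toℕ-suc%-mod i = trans (toℕ-fromℕ< _) (m%n%n≡m%n (suc i) k)

    mod-injective : InjectiveBelow k (_mod k)
    mod-injective i<k j<k eq = trans (sym (toℕ-mod-< i<k)) (trans (cong toℕ eq) (toℕ-mod-< j<k))

    edge : ∀ {i} → i < k → CycAdj k (i mod k) ((suc i % k) mod k)
    edge {i} i<k = ≡suc%⇒cycAdj (<⇒≤ 3≤k)
      (trans (toℕ-suc%-mod i) (cong (λ x → suc x % k) (sym (toℕ-mod-< i<k))))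

    colour-injective : InjectiveBelow k (cycleColour c k vertex)
    colour-injective {i} {j} i<k j<k eq with rainbow _ _ _ _ (edge i<k) (edge j<k) eq
    ... | inj₁ (i≡j , _)           = mod-injective i<k j<k i≡j
    ... | inj₂ (i≡suc[j] , suc[i]≡j) = ⊥-elim (m≢suc[suc[m]%n]%n 3≤k i<k (begin
      i                       ≡⟨ toℕ-mod-< i<k ⟨
      toℕ (i mod k)           ≡⟨ cong toℕ i≡suc[j] ⟩
      toℕ ((suc j % k) mod k) ≡⟨ toℕ-suc%-mod j ⟩
      suc j % k               ≡⟨ cong (λ x → suc x % k) j≡suc[i] ⟩
      suc (suc i % k) % k     ∎))
      where
      open ≡-Reasoning
      j≡suc[i] : j ≡ suc i % k
      j≡suc[i] = trans (sym (toℕ-mod-< j<k)) (trans (cong toℕ (sym suc[i]≡j)) (toℕ-suc%-mod i))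

module Chords {n : ℕ} {c : Coloring n} {m : ℕ} .{{_ : NonZero m}} (C : RainbowCycle c m) where

  open RainbowCycle C

  edgeColour : ℕ → ℕ
  edgeColour = cycleColour c m vertex

  chordColour : ℕ → ℕ
  chordColour p = col c (vertex 0) (vertex p)

  ChordColourAhead : ℕ → Set
  ChordColourAhead p = ∃[ i ] p ≤ i × i < m × chordColour p ≡ edgeColour i

  ¬chordColourAhead-1 : 1 < m → ¬ ChordColourAhead 1
  ¬chordColourAhead-1 1<m (i , 1≤i , i<m , chord≡) = <⇒≢ 1≤i (sym (colour-injective i<m (<-trans z<s 1<m)
    (trans (sym chord≡) (sym (cycleColour-< c vertex 1<m)))))

  chordColourAhead-pred : ChordColourAhead (pred m)
  chordColourAhead-pred =
    pred m , ≤-refl , m≤pred[n]⇒suc[m]≤n ≤-refl , sym (cycleColour-pred c vertex)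

  chordCycle : ∀ {p l} → 1 ≤ p → l + p < m → ¬ ChordColourAhead p → ChordColourAhead (l + p) →
               RainbowCycle c (2 + l)
  chordCycle {p} {l} 1≤p l+p<m ¬ahead (i , l+p≤i , i<m , chord≡) = record
    { vertex           = vertex ∘ σ
    ; vertex-injective = injectiveBelow-∘ vertex-injective σ-injective σ<m
    ; colour-injective = injectiveBelow-cons (injectiveBelow-snoc middle-injective last-new) first-new
    }
    where
    σ : ℕ → ℕ
    σ zero    = 0
    σ (suc x) = x + p

    +p-injective : ∀ {k} → InjectiveBelow k (_+ p)
    +p-injective _ _ = +-cancelʳ-≡ p _ _

    1+x+p<m : ∀ {x} → x < l → suc x + p < m
    1+x+p<m x<l = ≤-<-trans (+-monoˡ-≤ p x<l) l+p<m

    +p<m : ∀ {x} → x < l → x + p < m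
    +p<m x<l = <-trans (n<1+n _) (1+x+p<m x<l)

    σ<m : ∀ {x} → x < 2 + l → σ x < m
    σ<m {zero}  _       = ≤-<-trans z≤n l+p<m
    σ<m {suc x} 1+x<2+l = ≤-<-trans (+-monoˡ-≤ p (s≤s⁻¹ (s≤s⁻¹ 1+x<2+l))) l+p<m

    σ-injective : InjectiveBelow (2 + l) σ
    σ-injective = injectiveBelow-cons +p-injective 0≢x+p
      where
      0≢x+p : ∀ {x} → x < suc l → 0 ≢ x + p
      0≢x+p {x} _ = <⇒≢ (≤-trans 1≤p (m≤n+m p x))

    κ : ℕ → ℕ
    κ = cycleColour c (2 + l) (vertex ∘ σ)

    first : κ 0 ≡ chordColour p
    first = cycleColour-< c {2 + l} (vertex ∘ σ) (s≤s (s≤s z≤n))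

    middle : ∀ {x} → x < l → κ (suc x) ≡ edgeColour (x + p)
    middle x<l = trans (cycleColour-< c {2 + l} (vertex ∘ σ) (s≤s (s≤s x<l)))
                       (sym (cycleColour-< c vertex (1+x+p<m x<l)))

    last : κ (suc l) ≡ edgeColour i
    last = trans (cycleColour-pred c {2 + l} (vertex ∘ σ)) chord≡

    middle-injective : InjectiveBelow l (κ ∘ suc)
    middle-injective =
      injectiveBelow-resp (sym ∘ middle) (injectiveBelow-∘ colour-injective +p-injective +p<m)

    last-new : ∀ {x} → x < l → κ (suc x) ≢ κ (suc l)
    last-new x<l eq = <⇒≢ (<-≤-trans (+-monoˡ-< p x<l) l+p≤i)
      (colour-injective (+p<m x<l) i<m (trans (sym (middle x<l)) (trans eq last)))

    first-new : ∀ {x} → x < suc l → κ 0 ≢ κ (suc x)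
    first-new {x} x<1+l eq with m≤n⇒m<n∨m≡n (s≤s⁻¹ x<1+l)
    ... | inj₁ x<l  = ¬ahead (x + p , m≤n+m p x , +p<m x<l , trans (sym first) (trans eq (middle x<l)))
    ... | inj₂ refl = ¬ahead (i , ≤-trans (m≤n+m p l) l+p≤i , i<m , trans (sym first) (trans eq last))

rainbowCycle-shorten : ∀ {n} {c : Coloring n} d t →
                       ¬ RainbowCycle c (2 + d) → ¬ RainbowCycle c (2 + t * d)
rainbowCycle-shorten d t noShort C = ¬ahead t ≤-refl chordColourAhead-pred
  where
  open Chords C

  ¬ahead : ∀ j → j ≤ t → ¬ ChordColourAhead (suc (j * d))
  ¬ahead zero    _   = ¬chordColourAhead-1 (s≤s (s≤s z≤n))
  ¬ahead (suc j) j<t ahead = noShort (chordCycle (s≤s z≤n) bound (¬ahead j (<⇒≤ j<t))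
    (subst ChordColourAhead (sym (+-suc d (j * d))) ahead))
    where
    bound : d + suc (j * d) < 2 + t * d
    bound = subst (_< 2 + t * d) (sym (+-suc d (j * d))) (s≤s (s≤s (*-monoˡ-≤ d j<t)))

-- The implication holds for every colouring, so s = 1 suffices.
cycle-≼-longerCycle : (k t : ℕ) → 3 ≤ k → 1 ≤ t → Cycle k ≼ Cycle (t * (k ∸ 2) + 2)
cycle-≼-longerCycle (suc (suc (suc d))) (suc t) (s≤s (s≤s (s≤s _))) (s≤s _) =
  1 , ≤-refl , λ _ c _ noShort long →
    rainbowCycle-shorten (suc d) (suc t) (noShort ∘ rainbowCycle⇒rainbowCopy {c = c})
      (rainbowCopy⇒rainbowCycle (s≤s (s≤s (s≤s z≤n)))
        (subst (RainbowCopy c ∘ Cycle) (+-comm (suc t * suc d) 2) long))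

cycle4-≼-evenCycle : (t : ℕ) → 2 ≤ t → Cycle 4 ≼ Cycle (2 * t)
cycle4-≼-evenCycle (suc t) (s≤s 1≤t) =
  subst (λ m → Cycle 4 ≼ Cycle m) (trans (+-comm (t * 2) 2) (*-comm (suc t) 2))
    (cycle-≼-longerCycle 4 t (s≤s (s≤s (s≤s z≤n))) 1≤t)

theorem7 : ((k t : ℕ) → 3 ≤ k → 1 ≤ t → Cycle k ≼ Cycle (t * (k ∸ 2) + 2))
    × ((t : ℕ) → 2 ≤ t → Cycle 4 ≼ Cycle (2 * t))
theorem7 = cycle-≼-longerCycle , cycle4-≼-evenCycle
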